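{- The predicate modal logic $\mathsf{QGrz}+(\Box\exists x P(x)\to\Diamond\exists x\Box P(x))$ is not a modal companion of $\mathsf{IQC}$.
   Context: $\mathsf{IQC}$ is intuitionistic predicate calculus. $\mathsf{QS4}$ is the predicate extension of $\mathsf{S4}$ (classical predicate logic with the $\mathsf{S4}$ axioms and rules for $\Box$), $\Diamond=\neg\Box\neg$, and $\mathsf{QGrz}$ is $\mathsf{QS4}$ plus the Grzegorczyk axiom $\Box(\Box(p\to\Box p)\to p)\to p$ (all substitution instances). $\mathsf{QGrz}+\chi$ denotes the smallest predicate modal logic extending $\mathsf{QGrz}$ and containing $\chi$. The Gödel translation $(\cdot)^t$ from predicate intuitionistic formulas to predicate modal formulas is: $\bot^t=\bot$, $A^t=\Box A$ for atomic $A$, $(\varphi\wedge\psi)^t=\varphi^t\wedge\psi^t$, $(\varphi\vee\psi)^t=\varphi^t\vee\psi^t$, $(\varphi\to\psi)^t=\Box(\neg\varphi^t\vee\psi^t)$, $(\forall x\varphi)^t=\Box\forall x\varphi^t$, $(\exists x\varphi)^t=\exists x\varphi^t$. A predicate modal logic $\mathsf{M}$ containing $\mathsf{QS4}$ is a modal companion of $\mathsf{IQC}$ if for every predicate formula $\varphi$: $\mathsf{IQC}\vdash\varphi$ iff $\mathsf{M}\vdash\varphi^t$. -}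

module Defs where

open import Data.Nat using (ℕ; zero; suc)
open import Data.Fin using (Fin; zero; suc)
open import Data.Vec using (Vec)
import Data.Vec as Vec
open import Function.Bundles using (_⇔_)
open import Relation.Nullary using (¬_)

-- Variables are de Bruijn indices; a formula of type  Fml n  has its
-- free (individual) variables among  Fin n.  The only terms are
-- individual variables (pure predicate language, no function symbols,
-- no equality).  Predicate letters: a letter is a pair (k , i) of an
-- arity k and a name i; arity 0 gives propositional letters.

liftR : ∀ {m n} → (Fin m → Fin n) → Fin (suc m) → Fin (suc n)
liftR ρ zero    = zero
liftR ρ (suc i) = suc (ρ i)

inst₀ : ∀ {n} → Fin n → Fin (suc n) → Fin n
inst₀ y zero    = y
inst₀ y (suc i) = i

infixr 6 _∧ᵢ_
infixr 5 _∨ᵢ_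
infixr 4 _⇒ᵢ_

data IFml (n : ℕ) : Set where
  ⊥ᵢ   : IFml n
  atomᵢ : (k : ℕ) → ℕ → Vec (Fin n) k → IFml n
  _∧ᵢ_ _∨ᵢ_ _⇒ᵢ_ : IFml n → IFml n → IFml n
  ∀ᵢ ∃ᵢ : IFml (suc n) → IFml n

renᵢ : ∀ {m n} → (Fin m → Fin n) → IFml m → IFml n
renᵢ ρ ⊥ᵢ = ⊥ᵢ
renᵢ ρ (atomᵢ k P xs) = atomᵢ k P (Vec.map ρ xs)
renᵢ ρ (φ ∧ᵢ ψ) = renᵢ ρ φ ∧ᵢ renᵢ ρ ψ
renᵢ ρ (φ ∨ᵢ ψ) = renᵢ ρ φ ∨ᵢ renᵢ ρ ψ
renᵢ ρ (φ ⇒ᵢ ψ) = renᵢ ρ φ ⇒ᵢ renᵢ ρ ψ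
renᵢ ρ (∀ᵢ φ) = ∀ᵢ (renᵢ (liftR ρ) φ)
renᵢ ρ (∃ᵢ φ) = ∃ᵢ (renᵢ (liftR ρ) φ)

wkᵢ : ∀ {n} → IFml n → IFml (suc n)
wkᵢ = renᵢ suc

instᵢ : ∀ {n} → IFml (suc n) → Fin n → IFml n
instᵢ φ y = renᵢ (inst₀ y) φ

-- Hilbert-style calculus for IQC (nonempty domains).
-- IQC ⊢ φ  is  IQC⊢ φ  (φ possibly open).
data IQC⊢_ : ∀ {n} → IFml n → Set where
  ax-K   : ∀ {n} {φ ψ : IFml n} → IQC⊢ (φ ⇒ᵢ ψ ⇒ᵢ φ)
  ax-S   : ∀ {n} {φ ψ χ : IFml n} →
           IQC⊢ ((φ ⇒ᵢ ψ ⇒ᵢ χ) ⇒ᵢ (φ ⇒ᵢ ψ) ⇒ᵢ φ ⇒ᵢ χ)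
  ax-∧E₁ : ∀ {n} {φ ψ : IFml n} → IQC⊢ (φ ∧ᵢ ψ ⇒ᵢ φ)
  ax-∧E₂ : ∀ {n} {φ ψ : IFml n} → IQC⊢ (φ ∧ᵢ ψ ⇒ᵢ ψ)
  ax-∧I  : ∀ {n} {φ ψ : IFml n} → IQC⊢ (φ ⇒ᵢ ψ ⇒ᵢ φ ∧ᵢ ψ)
  ax-∨I₁ : ∀ {n} {φ ψ : IFml n} → IQC⊢ (φ ⇒ᵢ φ ∨ᵢ ψ)
  ax-∨I₂ : ∀ {n} {φ ψ : IFml n} → IQC⊢ (ψ ⇒ᵢ φ ∨ᵢ ψ)
  ax-∨E  : ∀ {n} {φ ψ χ : IFml n} →
           IQC⊢ ((φ ⇒ᵢ χ) ⇒ᵢ (ψ ⇒ᵢ χ) ⇒ᵢ φ ∨ᵢ ψ ⇒ᵢ χ)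
  ax-⊥E  : ∀ {n} {φ : IFml n} → IQC⊢ (⊥ᵢ ⇒ᵢ φ)
  ax-∀E  : ∀ {n} {φ : IFml (suc n)} (y : Fin n) → IQC⊢ (∀ᵢ φ ⇒ᵢ instᵢ φ y)
  ax-∃I  : ∀ {n} {φ : IFml (suc n)} (y : Fin n) → IQC⊢ (instᵢ φ y ⇒ᵢ ∃ᵢ φ)
  mp     : ∀ {n} {φ ψ : IFml n} → IQC⊢ (φ ⇒ᵢ ψ) → IQC⊢ φ → IQC⊢ ψ
  -- from  ψ → φ(x)  with x not free in ψ, infer  ψ → ∀x φ(x)
  ∀I     : ∀ {n} {ψ : IFml n} {φ : IFml (suc n)} →
           IQC⊢ (wkᵢ ψ ⇒ᵢ φ) → IQC⊢ (ψ ⇒ᵢ ∀ᵢ φ)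
  -- from  φ(x) → ψ  with x not free in ψ, infer  ∃x φ(x) → ψ
  ∃E     : ∀ {n} {ψ : IFml n} {φ : IFml (suc n)} →
           IQC⊢ (φ ⇒ᵢ wkᵢ ψ) → IQC⊢ (∃ᵢ φ ⇒ᵢ ψ)
  -- nonempty domains: a formula not containing a fresh variable x
  -- which is provable (in a context containing x) is provable
  strengthen : ∀ {n} {φ : IFml n} → IQC⊢ wkᵢ φ → IQC⊢ φ

infixr 6 _∧_
infixr 5 _∨_
infixr 4 _⇒_

data MFml (n : ℕ) : Set where
  ⊥    : MFml n
  atom : (k : ℕ) → ℕ → Vec (Fin n) k → MFml n
  _∧_ _∨_ _⇒_ : MFml n → MFml n → MFml n
  □    : MFml n → MFml n
  ∀′ ∃′ : MFml (suc n) → MFml n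

¬′_ : ∀ {n} → MFml n → MFml n
¬′ φ = φ ⇒ ⊥

◇ : ∀ {n} → MFml n → MFml n
◇ φ = ¬′ □ (¬′ φ)

ren : ∀ {m n} → (Fin m → Fin n) → MFml m → MFml n
ren ρ ⊥ = ⊥
ren ρ (atom k P xs) = atom k P (Vec.map ρ xs)
ren ρ (φ ∧ ψ) = ren ρ φ ∧ ren ρ ψ
ren ρ (φ ∨ ψ) = ren ρ φ ∨ ren ρ ψ
ren ρ (φ ⇒ ψ) = ren ρ φ ⇒ ren ρ ψ
ren ρ (□ φ) = □ (ren ρ φ)
ren ρ (∀′ φ) = ∀′ (ren (liftR ρ) φ)
ren ρ (∃′ φ) = ∃′ (ren (liftR ρ) φ)

wk : ∀ {n} → MFml n → MFml (suc n)
wk = ren suc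

inst : ∀ {n} → MFml (suc n) → Fin n → MFml n
inst φ y = ren (inst₀ y) φ

-- A set of extra axioms (closed under nothing in particular)
Axioms : Set₁
Axioms = ∀ {n} → MFml n → Set

data _⊢_ (Ax : Axioms) : ∀ {n} → MFml n → Set where
  ax-K   : ∀ {n} {φ ψ : MFml n} → Ax ⊢ (φ ⇒ ψ ⇒ φ)
  ax-S   : ∀ {n} {φ ψ χ : MFml n} →
           Ax ⊢ ((φ ⇒ ψ ⇒ χ) ⇒ (φ ⇒ ψ) ⇒ φ ⇒ χ)
  ax-∧E₁ : ∀ {n} {φ ψ : MFml n} → Ax ⊢ (φ ∧ ψ ⇒ φ)
  ax-∧E₂ : ∀ {n} {φ ψ : MFml n} → Ax ⊢ (φ ∧ ψ ⇒ ψ)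
  ax-∧I  : ∀ {n} {φ ψ : MFml n} → Ax ⊢ (φ ⇒ ψ ⇒ φ ∧ ψ)
  ax-∨I₁ : ∀ {n} {φ ψ : MFml n} → Ax ⊢ (φ ⇒ φ ∨ ψ)
  ax-∨I₂ : ∀ {n} {φ ψ : MFml n} → Ax ⊢ (ψ ⇒ φ ∨ ψ)
  ax-∨E  : ∀ {n} {φ ψ χ : MFml n} →
           Ax ⊢ ((φ ⇒ χ) ⇒ (ψ ⇒ χ) ⇒ φ ∨ ψ ⇒ χ)
  ax-⊥E  : ∀ {n} {φ : MFml n} → Ax ⊢ (⊥ ⇒ φ)
  ax-DNE : ∀ {n} {φ : MFml n} → Ax ⊢ (¬′ ¬′ φ ⇒ φ)
  ax-∀E  : ∀ {n} {φ : MFml (suc n)} (y : Fin n) → Ax ⊢ (∀′ φ ⇒ inst φ y)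
  ax-∃I  : ∀ {n} {φ : MFml (suc n)} (y : Fin n) → Ax ⊢ (inst φ y ⇒ ∃′ φ)
  ax-□K  : ∀ {n} {φ ψ : MFml n} → Ax ⊢ (□ (φ ⇒ ψ) ⇒ □ φ ⇒ □ ψ)
  ax-□T  : ∀ {n} {φ : MFml n} → Ax ⊢ (□ φ ⇒ φ)
  ax-□4  : ∀ {n} {φ : MFml n} → Ax ⊢ (□ φ ⇒ □ (□ φ))
  ax-extra : ∀ {n} {φ : MFml n} → Ax φ → Ax ⊢ φ
  mp     : ∀ {n} {φ ψ : MFml n} → Ax ⊢ (φ ⇒ ψ) → Ax ⊢ φ → Ax ⊢ ψ
  nec    : ∀ {n} {φ : MFml n} → Ax ⊢ φ → Ax ⊢ □ φ
  ∀I     : ∀ {n} {ψ : MFml n} {φ : MFml (suc n)} →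
           Ax ⊢ (wk ψ ⇒ φ) → Ax ⊢ (ψ ⇒ ∀′ φ)
  ∃E     : ∀ {n} {ψ : MFml n} {φ : MFml (suc n)} →
           Ax ⊢ (φ ⇒ wk ψ) → Ax ⊢ (∃′ φ ⇒ ψ)
  strengthen : ∀ {n} {φ : MFml n} → Ax ⊢ wk φ → Ax ⊢ φ

-- Axioms of QGrz + (□∃x P(x) → ◇∃x □P(x)): all substitution instances
-- of the Grzegorczyk axiom and of the extra axiom.  A substitution
-- instance of the latter replaces P(x) by an arbitrary formula ψ(x)
-- (possibly with further free variables), given here as ψ : MFml (suc n).
data GrzAx-χ : Axioms where
  grz : ∀ {n} (φ : MFml n) →
        GrzAx-χ (□ (□ (φ ⇒ □ φ) ⇒ φ) ⇒ φ)
  χ   : ∀ {n} (ψ : MFml (suc n)) →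
        GrzAx-χ (□ (∃′ ψ) ⇒ ◇ (∃′ (□ ψ)))

_ᵗ : ∀ {n} → IFml n → MFml n
⊥ᵢ ᵗ = ⊥
atomᵢ k P xs ᵗ = □ (atom k P xs)
(φ ∧ᵢ ψ) ᵗ = φ ᵗ ∧ ψ ᵗ
(φ ∨ᵢ ψ) ᵗ = φ ᵗ ∨ ψ ᵗ
(φ ⇒ᵢ ψ) ᵗ = □ (¬′ (φ ᵗ) ∨ ψ ᵗ)
∀ᵢ φ ᵗ = □ (∀′ (φ ᵗ))
∃ᵢ φ ᵗ = ∃′ (φ ᵗ)

IsModalCompanion : Axioms → Set
IsModalCompanion Ax = ∀ {n} (φ : IFml n) → (IQC⊢ φ) ⇔ (Ax ⊢ (φ ᵗ))

-- The formula ¬¬∃x(P x → ∀y P y) is refuted in the constant-domain Kripke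
-- model on ℕ in which P holds at world w of the elements below w: every
-- world sees a later one where a given P d holds, while ∀y P y holds nowhere.
-- Its Gödel translation is nevertheless derivable from □∃x ψ(x) → ◇∃x □ψ(x)
-- applied to the classically valid drinker formula ψ(x) = ¬□P x ∨ ∀y □P y:
-- in S4, □ψ(x) implies the translation of P x → ∀y P y, and ◇ of a
-- translation implies the translation of its double negation.
module Submission where

open import Defs
open import Data.Nat using (ℕ; zero; suc; _+_; _≤_; _<_)
open import Data.Nat.Properties using (≤-refl; ≤-trans; <-≤-trans; n≮n; m≤m+n; m≤n+m)
open import Data.Fin using (Fin; zero; suc)
open import Data.Vec using (Vec; []; _∷_)
import Data.Vec as Vec
open import Data.Vec.Properties using (map-∘; map-cong; map-id)
open import Data.Vec.Relation.Unary.All as All using (All; []; _∷_)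
open import Data.Vec.Functional using () renaming (_∷_ to _∷ᶠ_)
open import Data.Product using (Σ; _×_; _,_)
open import Data.Product.Function.NonDependent.Propositional using (_×-⇔_)
open import Data.Sum using (_⊎_; inj₁; inj₂)
open import Data.Sum.Function.Propositional using (_⊎-⇔_)
import Data.Empty as Empty
open import Function using (_∘_)
open import Function.Bundles using (_⇔_; mk⇔; Equivalence)
open import Function.Construct.Identity using (⇔-id)
open import Relation.Nullary using (¬_)
open import Relation.Binary.PropositionalEquality using (_≡_; refl; sym; trans; cong; cong₂; subst)

open Equivalence using (to; from)

liftR-inverse : ∀ {m n} {σ : Fin n → Fin m} {τ : Fin m → Fin n} →
                (∀ i → σ (τ i) ≡ i) → ∀ i → liftR σ (liftR τ i) ≡ i
liftR-inverse eq zero    = refl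
liftR-inverse eq (suc i) = cong suc (eq i)

ren-inverse : ∀ {m n} {σ : Fin n → Fin m} {τ : Fin m → Fin n} →
              (∀ i → σ (τ i) ≡ i) → (φ : MFml m) → ren σ (ren τ φ) ≡ φ
ren-inverse eq ⊥ = refl
ren-inverse {σ = σ} {τ} eq (atom k P xs) =
  cong (atom k P) (trans (sym (map-∘ σ τ xs)) (trans (map-cong eq xs) (map-id xs)))
ren-inverse eq (φ ∧ ψ) = cong₂ _∧_ (ren-inverse eq φ) (ren-inverse eq ψ)
ren-inverse eq (φ ∨ ψ) = cong₂ _∨_ (ren-inverse eq φ) (ren-inverse eq ψ)
ren-inverse eq (φ ⇒ ψ) = cong₂ _⇒_ (ren-inverse eq φ) (ren-inverse eq ψ)
ren-inverse eq (□ φ)   = cong □ (ren-inverse eq φ)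
ren-inverse eq (∀′ φ)  = cong ∀′ (ren-inverse (liftR-inverse eq) φ)
ren-inverse eq (∃′ φ)  = cong ∃′ (ren-inverse (liftR-inverse eq) φ)

inst-zero-liftR-wk : ∀ {n} (φ : MFml (suc n)) → inst (ren (liftR suc) φ) zero ≡ φ
inst-zero-liftR-wk = ren-inverse λ { zero → refl ; (suc i) → refl }

Drinker : ∀ {n} → MFml (suc n) → MFml (suc n)
Drinker φ = ¬′ φ ∨ wk (∀′ φ)

module Derivations {Ax : Axioms} where

  I : ∀ {n} {φ : MFml n} → Ax ⊢ (φ ⇒ φ)
  I {φ = φ} = mp (mp ax-S (ax-K {ψ = φ ⇒ φ})) (ax-K {ψ = φ})

  const : ∀ {n} {φ ψ : MFml n} → Ax ⊢ ψ → Ax ⊢ (φ ⇒ ψ)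
  const = mp ax-K

  S : ∀ {n} {φ ψ χ : MFml n} → Ax ⊢ (φ ⇒ ψ ⇒ χ) → Ax ⊢ (φ ⇒ ψ) → Ax ⊢ (φ ⇒ χ)
  S f g = mp (mp ax-S f) g

  _∘ᴴ_ : ∀ {n} {φ ψ χ : MFml n} → Ax ⊢ (ψ ⇒ χ) → Ax ⊢ (φ ⇒ ψ) → Ax ⊢ (φ ⇒ χ)
  f ∘ᴴ g = S (const f) g

  ∧-intro : ∀ {n} {φ ψ χ : MFml n} → Ax ⊢ (φ ⇒ ψ) → Ax ⊢ (φ ⇒ χ) → Ax ⊢ (φ ⇒ ψ ∧ χ)
  ∧-intro f g = S (ax-∧I ∘ᴴ f) g

  ∨-elim : ∀ {n} {φ ψ χ : MFml n} → Ax ⊢ (φ ⇒ χ) → Ax ⊢ (ψ ⇒ χ) → Ax ⊢ (φ ∨ ψ ⇒ χ)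
  ∨-elim f g = mp (mp ax-∨E f) g

  curry : ∀ {n} {Γ φ ψ : MFml n} → Ax ⊢ (Γ ∧ φ ⇒ ψ) → Ax ⊢ (Γ ⇒ φ ⇒ ψ)
  curry f = mp ax-S (const f) ∘ᴴ ax-∧I

  uncurry : ∀ {n} {Γ φ ψ : MFml n} → Ax ⊢ (Γ ⇒ φ ⇒ ψ) → Ax ⊢ (Γ ∧ φ ⇒ ψ)
  uncurry f = S (f ∘ᴴ ax-∧E₁) ax-∧E₂

  contraposition : ∀ {n} {φ ψ : MFml n} → Ax ⊢ (φ ⇒ ψ) → Ax ⊢ (¬′ ψ ⇒ ¬′ φ)
  contraposition f = curry (S ax-∧E₁ (f ∘ᴴ ax-∧E₂))

  excluded-middle : ∀ {n} {φ : MFml n} → Ax ⊢ (φ ∨ ¬′ φ)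
  excluded-middle = mp ax-DNE (S I (ax-∨I₂ ∘ᴴ contraposition ax-∨I₁))

  ⇒-to-∨ : ∀ {n} {Γ φ ψ : MFml n} → Ax ⊢ (Γ ⇒ φ ⇒ ψ) → Ax ⊢ (Γ ⇒ ¬′ φ ∨ ψ)
  ⇒-to-∨ f =
    S (S (ax-∨E ∘ᴴ curry (ax-∨I₂ ∘ᴴ uncurry f)) (const ax-∨I₁)) (const excluded-middle)

  □-mono : ∀ {n} {φ ψ : MFml n} → Ax ⊢ (φ ⇒ ψ) → Ax ⊢ (□ φ ⇒ □ ψ)
  □-mono f = mp ax-□K (nec f)

  ◇-mono : ∀ {n} {φ ψ : MFml n} → Ax ⊢ (φ ⇒ ψ) → Ax ⊢ (◇ φ ⇒ ◇ ψ)
  ◇-mono f = contraposition (□-mono (contraposition f))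

  ∃-intro₀ : ∀ {n} {φ : MFml (suc n)} → Ax ⊢ (φ ⇒ wk (∃′ φ))
  ∃-intro₀ {φ = φ} =
    subst (λ ψ → Ax ⊢ (ψ ⇒ wk (∃′ φ))) (inst-zero-liftR-wk φ) (ax-∃I zero)

  ∃-mono : ∀ {n} {φ ψ : MFml (suc n)} → Ax ⊢ (φ ⇒ ψ) → Ax ⊢ (∃′ φ ⇒ ∃′ ψ)
  ∃-mono f = ∃E (∃-intro₀ ∘ᴴ f)

  □[¬□∨]⇒□[¬□∨□] : ∀ {n} {φ ψ : MFml n} → Ax ⊢ (□ (¬′ □ φ ∨ ψ) ⇒ □ (¬′ □ φ ∨ □ ψ))
  □[¬□∨]⇒□[¬□∨□] = □-mono (⇒-to-∨ □[¬□∨]⇒□⇒□) ∘ᴴ ax-□4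
    where
    ¬□∨⇒□⇒ : ∀ {n} {φ ψ : MFml n} → Ax ⊢ ((¬′ □ φ ∨ ψ) ⇒ □ φ ⇒ ψ)
    ¬□∨⇒□⇒ = ∨-elim (curry (ax-⊥E ∘ᴴ S ax-∧E₁ ax-∧E₂)) ax-K
    □[¬□∨]⇒□⇒□ : ∀ {n} {φ ψ : MFml n} → Ax ⊢ (□ (¬′ □ φ ∨ ψ) ⇒ □ φ ⇒ □ ψ)
    □[¬□∨]⇒□⇒□ =
      curry (uncurry (ax-□K ∘ᴴ □-mono ¬□∨⇒□⇒) ∘ᴴ ∧-intro ax-∧E₁ (ax-□4 ∘ᴴ ax-∧E₂))

  drinker : ∀ {n} {φ : MFml (suc n)} → Ax ⊢ ∃′ (Drinker φ)
  drinker {φ = φ} = strengthen (mp ax-DNE refuted)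
    where
    witness : Ax ⊢ (Drinker φ ⇒ wk (∃′ (Drinker φ)))
    witness = ∃-intro₀
    -- in the context (x , y) with y the variable 0, ¬φ(y) makes y a drinker
    counterexample : Ax ⊢ (¬′ ren (liftR suc) φ ⇒ wk (wk (∃′ (Drinker φ))))
    counterexample = ∃-intro₀ {φ = ren (liftR suc) (Drinker φ)} ∘ᴴ ax-∨I₁
    refuted : Ax ⊢ (¬′ wk (∃′ (Drinker φ)) ⇒ ⊥)
    refuted = S (contraposition (witness ∘ᴴ ax-∨I₂))
                (∀I (ax-DNE ∘ᴴ contraposition counterexample))

open Derivations

Pᵢ : ∀ {n} → Fin n → IFml n
Pᵢ x = atomᵢ 1 0 (x ∷ [])

¬ᵢ_ : ∀ {n} → IFml n → IFml n
¬ᵢ φ = φ ⇒ᵢ ⊥ᵢ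

drinkerᵢ : IFml 1
drinkerᵢ = Pᵢ zero ⇒ᵢ ∀ᵢ (Pᵢ zero)

¬¬∃drinkerᵢ : IFml 0
¬¬∃drinkerᵢ = ¬ᵢ ¬ᵢ ∃ᵢ drinkerᵢ

◇⇒¬¬ᵗ : ∀ {Ax : Axioms} {n} {φ : IFml n} → Ax ⊢ ◇ (φ ᵗ) → Ax ⊢ ((¬ᵢ ¬ᵢ φ) ᵗ)
◇⇒¬¬ᵗ ◇φᵗ = nec (mp ax-∨I₁ (mp (contraposition (□-mono (∨-elim I ax-⊥E))) ◇φᵗ))

χ⊢¬¬∃drinkerᵢᵗ : ∀ {Ax : Axioms} → ((ψ : MFml 1) → Ax ⊢ (□ (∃′ ψ) ⇒ ◇ (∃′ (□ ψ)))) →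
                 Ax ⊢ (¬¬∃drinkerᵢ ᵗ)
χ⊢¬¬∃drinkerᵢᵗ χ-ax =
  ◇⇒¬¬ᵗ {φ = ∃ᵢ drinkerᵢ} (mp (◇-mono (∃-mono □[¬□∨]⇒□[¬□∨□])) (mp (χ-ax _) (nec drinker)))

record KripkeModel : Set₁ where
  field
    World   : Set
    _≼_     : World → World → Set
    ≼-refl  : ∀ {w} → w ≼ w
    ≼-trans : ∀ {u v w} → u ≼ v → v ≼ w → u ≼ w
    Domain  : Set
    element : Domain
    Holds   : World → (k : ℕ) → ℕ → Vec Domain k → Set
    Holds-mono : ∀ {w v k P ds} → w ≼ v → Holds w k P ds → Holds v k P ds

module Forcing (M : KripkeModel) where
  open KripkeModel M

  infix 3 _⊩[_]_

  _⊩[_]_ : ∀ {n} → World → (Fin n → Domain) → IFml n → Set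
  w ⊩[ ρ ] ⊥ᵢ           = Empty.⊥
  w ⊩[ ρ ] atomᵢ k P xs = Holds w k P (Vec.map ρ xs)
  w ⊩[ ρ ] φ ∧ᵢ ψ       = w ⊩[ ρ ] φ × w ⊩[ ρ ] ψ
  w ⊩[ ρ ] φ ∨ᵢ ψ       = w ⊩[ ρ ] φ ⊎ w ⊩[ ρ ] ψ
  w ⊩[ ρ ] φ ⇒ᵢ ψ       = ∀ v → w ≼ v → v ⊩[ ρ ] φ → v ⊩[ ρ ] ψ
  w ⊩[ ρ ] ∀ᵢ φ         = ∀ v → w ≼ v → ∀ d → v ⊩[ d ∷ᶠ ρ ] φ
  w ⊩[ ρ ] ∃ᵢ φ         = Σ Domain λ d → w ⊩[ d ∷ᶠ ρ ] φ

  ⊩-mono : ∀ {n w v} {ρ : Fin n → Domain} (φ : IFml n) → w ≼ v → w ⊩[ ρ ] φ → v ⊩[ ρ ] φ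
  ⊩-mono ⊥ᵢ             w≼v ()
  ⊩-mono (atomᵢ k P xs) w≼v h        = Holds-mono w≼v h
  ⊩-mono (φ ∧ᵢ ψ)       w≼v (a , b)  = ⊩-mono φ w≼v a , ⊩-mono ψ w≼v b
  ⊩-mono (φ ∨ᵢ ψ)       w≼v (inj₁ a) = inj₁ (⊩-mono φ w≼v a)
  ⊩-mono (φ ∨ᵢ ψ)       w≼v (inj₂ b) = inj₂ (⊩-mono ψ w≼v b)
  ⊩-mono (φ ⇒ᵢ ψ)       w≼v h        = λ u v≼u → h u (≼-trans w≼v v≼u)
  ⊩-mono (∀ᵢ φ)         w≼v h        = λ u v≼u → h u (≼-trans w≼v v≼u)
  ⊩-mono (∃ᵢ φ)         w≼v (d , h)  = d , ⊩-mono φ w≼v h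

  ∷-liftR : ∀ {m n} {ρ : Fin n → Domain} {ρ′ : Fin m → Domain} {σ : Fin m → Fin n} (d : Domain) →
            (∀ i → ρ (σ i) ≡ ρ′ i) → ∀ i → (d ∷ᶠ ρ) (liftR σ i) ≡ (d ∷ᶠ ρ′) i
  ∷-liftR d eq zero    = refl
  ∷-liftR d eq (suc i) = eq i

  ⊩-ren : ∀ {m n w} {ρ : Fin n → Domain} {ρ′ : Fin m → Domain} (σ : Fin m → Fin n) →
          (∀ i → ρ (σ i) ≡ ρ′ i) → (φ : IFml m) → (w ⊩[ ρ ] renᵢ σ φ) ⇔ (w ⊩[ ρ′ ] φ)
  ⊩-ren σ eq ⊥ᵢ = ⇔-id _
  ⊩-ren {w = w} {ρ} σ eq (atomᵢ k P xs) =
    mk⇔ (subst (Holds w k P) ρσ≡ρ′) (subst (Holds w k P) (sym ρσ≡ρ′))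
    where
    ρσ≡ρ′ : Vec.map ρ (Vec.map σ xs) ≡ Vec.map _ xs
    ρσ≡ρ′ = trans (sym (map-∘ ρ σ xs)) (map-cong eq xs)
  ⊩-ren σ eq (φ ∧ᵢ ψ) = ⊩-ren σ eq φ ×-⇔ ⊩-ren σ eq ψ
  ⊩-ren σ eq (φ ∨ᵢ ψ) = ⊩-ren σ eq φ ⊎-⇔ ⊩-ren σ eq ψ
  ⊩-ren σ eq (φ ⇒ᵢ ψ) =
    mk⇔ (λ h v w≼v a → to   (⊩-ren σ eq ψ) (h v w≼v (from (⊩-ren σ eq φ) a)))
        (λ h v w≼v a → from (⊩-ren σ eq ψ) (h v w≼v (to   (⊩-ren σ eq φ) a)))
  ⊩-ren σ eq (∀ᵢ φ) =
    mk⇔ (λ h v w≼v d → to   (⊩-ren (liftR σ) (∷-liftR d eq) φ) (h v w≼v d))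
        (λ h v w≼v d → from (⊩-ren (liftR σ) (∷-liftR d eq) φ) (h v w≼v d))
  ⊩-ren σ eq (∃ᵢ φ) =
    mk⇔ (λ { (d , h) → d , to   (⊩-ren (liftR σ) (∷-liftR d eq) φ) h })
        (λ { (d , h) → d , from (⊩-ren (liftR σ) (∷-liftR d eq) φ) h })

  ⊩-wk : ∀ {n w d} {ρ : Fin n → Domain} (φ : IFml n) → (w ⊩[ d ∷ᶠ ρ ] wkᵢ φ) ⇔ (w ⊩[ ρ ] φ)
  ⊩-wk = ⊩-ren suc (λ _ → refl)

  ⊩-inst : ∀ {n w} {ρ : Fin n → Domain} (φ : IFml (suc n)) (y : Fin n) →
           (w ⊩[ ρ ] instᵢ φ y) ⇔ (w ⊩[ ρ y ∷ᶠ ρ ] φ)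
  ⊩-inst φ y = ⊩-ren (inst₀ y) (λ { zero → refl ; (suc i) → refl }) φ

  sound : ∀ {n} {φ : IFml n} → IQC⊢ φ → ∀ w (ρ : Fin n → Domain) → w ⊩[ ρ ] φ
  sound {φ = φ ⇒ᵢ _} ax-K w ρ v _ a u v≼u _ = ⊩-mono φ v≼u a
  sound ax-S w ρ v _ f u v≼u g t u≼t a = f t (≼-trans v≼u u≼t) a t ≼-refl (g t u≼t a)
  sound ax-∧E₁ w ρ v _ (a , _) = a
  sound ax-∧E₂ w ρ v _ (_ , b) = b
  sound {φ = φ ⇒ᵢ _} ax-∧I w ρ v _ a u v≼u b = ⊩-mono φ v≼u a , b
  sound ax-∨I₁ w ρ v _ a = inj₁ a
  sound ax-∨I₂ w ρ v _ b = inj₂ b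
  sound ax-∨E w ρ v _ f u v≼u g t u≼t (inj₁ a) = f t (≼-trans v≼u u≼t) a
  sound ax-∨E w ρ v _ f u v≼u g t u≼t (inj₂ b) = g t u≼t b
  sound ax-⊥E w ρ v _ ()
  sound {φ = ∀ᵢ φ ⇒ᵢ _} (ax-∀E y) w ρ v _ h = from (⊩-inst φ y) (h v ≼-refl (ρ y))
  sound {φ = _ ⇒ᵢ ∃ᵢ φ} (ax-∃I y) w ρ v _ h = ρ y , to (⊩-inst φ y) h
  sound (mp d e) w ρ = sound d w ρ w ≼-refl (sound e w ρ)
  sound {φ = ψ ⇒ᵢ ∀ᵢ φ} (∀I d) w ρ v _ a u v≼u e =
    sound d v (e ∷ᶠ ρ) u v≼u (from (⊩-wk ψ) (⊩-mono ψ v≼u a))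
  sound {φ = ∃ᵢ φ ⇒ᵢ ψ} (∃E d) w ρ v _ (e , a) = to (⊩-wk ψ) (sound d v (e ∷ᶠ ρ) v ≼-refl a)
  sound {φ = φ} (strengthen d) w ρ = to (⊩-wk φ) (sound d w (element ∷ᶠ ρ))

growing : KripkeModel
growing = record
  { World = ℕ ; _≼_ = _≤_ ; ≼-refl = ≤-refl ; ≼-trans = ≤-trans
  ; Domain = ℕ ; element = 0
  ; Holds = λ w _ _ → All (_< w)
  ; Holds-mono = λ w≤v → All.map (λ d<w → <-≤-trans d<w w≤v)
  }

open Forcing growing

growing-⊮¬¬∃drinkerᵢ : ¬ (0 ⊩[ (λ ()) ] ¬¬∃drinkerᵢ)
growing-⊮¬¬∃drinkerᵢ h = h 0 ≤-refl ⊩¬∃drinkerᵢ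
  where
  ⊮∀P : ∀ {w} {ρ : Fin 1 → ℕ} → ¬ (w ⊩[ ρ ] ∀ᵢ (Pᵢ zero))
  ⊮∀P {w} h with h w ≤-refl w
  ... | w<w ∷ [] = n≮n w w<w
  ⊩¬∃drinkerᵢ : 0 ⊩[ (λ ()) ] ¬ᵢ ∃ᵢ drinkerᵢ
  ⊩¬∃drinkerᵢ u _ (d , P⇒∀P) =
    ⊮∀P {ρ = d ∷ᶠ λ ()} (P⇒∀P (u + suc d) (m≤m+n u (suc d)) (m≤n+m (suc d) u ∷ []))

IQC⊬¬¬∃drinkerᵢ : ¬ IQC⊢ ¬¬∃drinkerᵢ
IQC⊬¬¬∃drinkerᵢ ⊢θ = growing-⊮¬¬∃drinkerᵢ (sound ⊢θ 0 (λ ()))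

theorem5p12 : ¬ IsModalCompanion GrzAx-χ
theorem5p12 companion =
  IQC⊬¬¬∃drinkerᵢ (from (companion ¬¬∃drinkerᵢ) (χ⊢¬¬∃drinkerᵢᵗ (ax-extra ∘ χ)))
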